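{- There exists a lobster $S$ of diameter $5$ (so $S$ has exactly two central vertices, say $x$ and $y$) such that there is no $\alpha$-labeling of $S$ in which one of the two central vertices is labeled by the critical number and the other central vertex is labeled by the maximum label $|V(S)|-1$. For instance, one may take $S$ to be the tree on vertices $u_1,u_2,v_1,v,v_2,u_3,v_3$ with edges $u_1v_1,\ u_2v_1,\ v_1v,\ vv_2,\ v_2u_3,\ u_3v_3$ (whose central vertices are $v$ and $v_2$).
   Context: A graceful labeling of a tree $T$ on $n$ vertices is an injective map $f:V(T)\to\{0,1,\dots,n-1\}$ such that the edge weights $|f(u)-f(w)|$, over all edges $uw$, are exactly $\{1,\dots,n-1\}$. A labeling $f$ is bipartite if there is an integer $c$ such that for every edge $uw$, either $f(u)\le c<f(w)$ or $f(w)\le c<f(u)$; a graceful bipartite labeling is called an $\alpha$-labeling, and $c$ is its critical number. A lobster is a tree in which every vertex is at distance at most $2$ from some fixed longest path. The central vertices of a tree are the vertices of minimum eccentricity (the middle vertex or two middle vertices of a longest path). -}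

module Defs where

open import Data.Nat using (ℕ; zero; suc; _≤_; _<_; _∸_; ∣_-_∣)
open import Data.Fin using (Fin)
open import Data.List using (List; length)
open import Data.List.Membership.Propositional using (_∈_)
open import Data.List.Relation.Unary.All using (All)
open import Data.List.Relation.Unary.AllPairs using (AllPairs)
open import Data.List.Relation.Unary.Linked using (Linked)
open import Data.List.Relation.Unary.Unique.Propositional using (Unique)
open import Data.Product using (Σ; ∃; _×_; _,_; proj₁; proj₂)
open import Data.Sum using (_⊎_)
open import Relation.Binary.PropositionalEquality using (_≡_; _≢_)
open import Relation.Nullary using (¬_)
open import Function.Bundles using (_⇔_)
open import Function.Definitions using (Injective)

-- A (simple) graph on vertex set Fin n, given by a list of undirected edges.
EdgeList : ℕ → Set
EdgeList n = List (Fin n × Fin n)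

Adjacent : ∀ {n} → EdgeList n → Fin n → Fin n → Set
Adjacent E u w = ((u , w) ∈ E) ⊎ ((w , u) ∈ E)

SameEdge : ∀ {n} → Fin n × Fin n → Fin n × Fin n → Set
SameEdge (a , b) (c , d) = ((a ≡ c) × (b ≡ d)) ⊎ ((a ≡ d) × (b ≡ c))

Simple : ∀ {n} → EdgeList n → Set
Simple E = All (λ e → proj₁ e ≢ proj₂ e) E × AllPairs (λ e f → ¬ SameEdge e f) E

data Walk {n : ℕ} (E : EdgeList n) : Fin n → Fin n → ℕ → Set where
  here : ∀ {u} → Walk E u u zero
  step : ∀ {u v w k} → Adjacent E u v → Walk E v w k → Walk E u w (suc k)

Connected : ∀ {n} → EdgeList n → Set
Connected {n} E = (u w : Fin n) → ∃ λ k → Walk E u w k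

IsTree : ∀ {n} → EdgeList n → Set
IsTree {n} E = 1 ≤ n × Simple E × Connected E × suc (length E) ≡ n

Dist : ∀ {n} → EdgeList n → Fin n → Fin n → ℕ → Set
Dist E u w d = Walk E u w d × (∀ k → Walk E u w k → d ≤ k)

Ecc : ∀ {n} → EdgeList n → Fin n → ℕ → Set
Ecc {n} E v e = (∀ w d → Dist E v w d → d ≤ e) × (∃ λ w → Dist E v w e)

Central : ∀ {n} → EdgeList n → Fin n → Set
Central {n} E v = ∃ λ e → Ecc E v e × (∀ (w : Fin n) e′ → Ecc E w e′ → e ≤ e′)

Diameter : ∀ {n} → EdgeList n → ℕ → Set
Diameter {n} E D =
  (∀ (u w : Fin n) d → Dist E u w d → d ≤ D) × (∃ λ u → ∃ λ w → Dist E u w D)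

IsPath : ∀ {n} → EdgeList n → List (Fin n) → Set
IsPath E p = Unique p × Linked (Adjacent E) p

IsLongestPath : ∀ {n} → EdgeList n → List (Fin n) → Set
IsLongestPath {n} E p = IsPath E p × (∀ (q : List (Fin n)) → IsPath E q → length q ≤ length p)

IsLobster : ∀ {n} → EdgeList n → Set
IsLobster {n} E = IsTree E × Σ (List (Fin n)) λ p → IsLongestPath E p ×
  (∀ (v : Fin n) → ∃ λ w → w ∈ p × ∃ λ d → Dist E v w d × d ≤ 2)

Graceful : ∀ {n} → EdgeList n → (Fin n → ℕ) → Set
Graceful {n} E f = Injective _≡_ _≡_ f × (∀ v → f v < n) ×
  (∀ k → ((1 ≤ k × k ≤ n ∸ 1) ⇔ (∃ λ u → ∃ λ w → (u , w) ∈ E × ∣ f u - f w ∣ ≡ k)))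

BipartiteWith : ∀ {n} → EdgeList n → (Fin n → ℕ) → ℕ → Set
BipartiteWith E f c = All (λ e → (f (proj₁ e) ≤ c × c < f (proj₂ e)) ⊎ (f (proj₂ e) ≤ c × c < f (proj₁ e))) E

AlphaLabeling : ∀ {n} → EdgeList n → (Fin n → ℕ) → ℕ → Set
AlphaLabeling E f c = Graceful E f × BipartiteWith E f c

-- Every α-labeling of S splits the vertices into the low side {u₁, u₂, v, u₃} and the high side
-- {v₁, v₂, v₃} (or conversely).  If a centre carries the critical number c and the other centre
-- the maximum 6, the edge of weight 6 and the edge of weight 1 (whose end labels must be c and
-- c + 1) each leave a single choice, and counting the remaining labels on each side pins c down.
-- The labeling is then determined up to the labels of the leaves u₁, u₂, and one edge weight in
-- {1, …, 6} is missing: 4 when v carries c, and 3 when v₂ does.  The metric facts about S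
-- (a lobster of diameter 5 whose centres are v and v₂) are decided by evaluation.
module Submission where

open import Defs
open import Data.Nat using (ℕ; _∸_)
open import Data.Fin using (Fin)
open import Data.Product using (Σ; ∃; _×_; _,_)
open import Relation.Binary.PropositionalEquality using (_≡_; _≢_)
open import Relation.Nullary using (¬_)

open import Data.Nat using (zero; suc; _+_; _≤_; _<_; z≤n; s≤s; s≤s⁻¹; _<?_; ∣_-_∣)
open import Data.Nat.Properties
  using (≤-antisym; ≤-trans; ≤-refl; ≤-reflexive; <⇒≤; <⇒≱; ≮⇒≥; ≤∧≢⇒<; n≤0⇒n≡0; n≢0⇒n>0; <-cmp; ⊔-lub;
         ∣m-n∣≤m⊔n; ∣-∣-comm; ∣-∣-identityʳ; m≤n⇒∣m-n∣≡n∸m; m∸n+n≡m; anyUpTo?)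
open import Data.Nat.Induction using (<-rec)
open import Data.Fin using (zero; suc)
open import Data.Fin.Properties using (_≟_; any?; all?)
open import Data.Product using (∃₂; proj₁; proj₂; uncurry)
open import Data.Product.Properties using (≡-dec)
open import Data.Sum using (_⊎_; inj₁; inj₂; swap)
open import Data.Empty using (⊥; ⊥-elim)
open import Data.List using (List; []; _∷_; length; map)
open import Data.List.Properties using (map-cong)
open import Data.List.Relation.Unary.All as All using (All; []; _∷_)
open import Data.List.Relation.Unary.Any using (Any; here; there)
import Data.List.Relation.Unary.Any as Any
open import Data.List.Relation.Unary.AllPairs using (allPairs?; _∷_)
open import Data.List.Relation.Unary.Linked using (Linked; linked?; _∷_)
open import Data.List.Relation.Unary.Unique.Propositional using (Unique)
open import Data.List.Membership.Propositional using (_∈_; _∉_; find)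
open import Data.List.Membership.Propositional.Properties using (∈-map⁺)
import Data.List.Membership.DecPropositional as DecMembership
open import Relation.Binary.Definitions using (tri<; tri≈; tri>)
open import Relation.Binary.PropositionalEquality using (_≗_; refl; sym; trans; cong; cong₂; subst; ≢-sym)
open import Relation.Nullary using (Dec; yes; no; ¬?)
open import Relation.Nullary.Decidable using (True; toWitness; map′; _×-dec_; _⊎-dec_; _→-dec_; from-yes)
open import Function using (_∘_)
open import Function.Bundles using (Equivalence)

module _ {n : ℕ} (E : EdgeList n) where

  adjacent? : ∀ u w → Dec (Adjacent E u w)
  adjacent? u w = ((u , w) ∈? E) ⊎-dec ((w , u) ∈? E)
    where open DecMembership (≡-dec _≟_ _≟_)

  simple? : Dec (Simple E)
  simple? = All.all? (λ (u , w) → ¬? (u ≟ w)) E ×-dec allPairs? (λ e e′ → ¬? (sameEdge? e e′)) E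
    where
    sameEdge? : ∀ e e′ → Dec (SameEdge e e′)
    sameEdge? (a , b) (c , d) = ((a ≟ c) ×-dec (b ≟ d)) ⊎-dec ((a ≟ d) ×-dec (b ≟ c))

  isPath? : ∀ p → Dec (IsPath E p)
  isPath? p = allPairs? (λ u w → ¬? (u ≟ w)) p ×-dec linked? adjacent? p

  walk? : ∀ k u w → Dec (Walk E u w k)
  walk? zero u w = map′ (λ { refl → here }) (λ { here → refl }) (u ≟ w)
  walk? (suc k) u w =
    map′ (λ (x , u~x , walk) → step u~x walk) (λ { (step u~x walk) → _ , u~x , walk })
         (any? λ x → adjacent? u x ×-dec walk? k x w)

  ShorterWalk : Fin n → Fin n → ℕ → Set
  ShorterWalk u w d = ∃ λ k → k < d × Walk E u w k

  walk-without-shorter⇒dist : ∀ {u w d} → Walk E u w d → ¬ ShorterWalk u w d → Dist E u w d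
  walk-without-shorter⇒dist walk none = walk , λ k walk′ → ≮⇒≥ (λ k<d → none (k , k<d , walk′))

  dist? : ∀ u w d → Dec (Dist E u w d)
  dist? u w d = map′ (uncurry walk-without-shorter⇒dist) (λ (walk , minimal) → walk , no-shorter minimal)
                     (walk? d u w ×-dec ¬? (anyUpTo? (λ k → walk? k u w) d))
    where
    no-shorter : (∀ k → Walk E u w k → d ≤ k) → ¬ ShorterWalk u w d
    no-shorter minimal (k , k<d , walk) = <⇒≱ k<d (minimal k walk)

  walk⇒dist : ∀ {u w} k → Walk E u w k → ∃ λ d → Dist E u w d
  walk⇒dist {u} {w} = <-rec _ shorten
    where
    shorten : ∀ k → (∀ {j} → j < k → Walk E u w j → ∃ λ d → Dist E u w d) → Walk E u w k → ∃ λ d → Dist E u w d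
    shorten k recurse walk with anyUpTo? (λ j → walk? j u w) k
    ... | yes (j , j<k , walk′) = recurse j<k walk′
    ... | no none = k , walk-without-shorter⇒dist walk none

  ReachableIn : ℕ → Fin n → Fin n → Set
  ReachableIn D u w = ShorterWalk u w (suc D)

  reachableIn? : ∀ D u w → Dec (ReachableIn D u w)
  reachableIn? D u w = anyUpTo? (λ k → walk? k u w) (suc D)

  dist≤reach : ∀ {D u w d} → ReachableIn D u w → Dist E u w d → d ≤ D
  dist≤reach (k , k<1+D , walk) (_ , minimal) = ≤-trans (minimal k walk) (s≤s⁻¹ k<1+D)

  connected : ∀ {D} → (∀ u w → ReachableIn D u w) → Connected E
  connected reach u w = let (k , _ , walk) = reach u w in k , walk

  diameter : ∀ {D} → (∀ u w → ReachableIn D u w) → (∃₂ λ u w → Dist E u w D) → Diameter E D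
  diameter reach far = (λ u w d δ → dist≤reach (reach u w) δ) , far

  eccentricity : ∀ {e u} → (∀ w → ReachableIn e u w) → (∃ λ w → Dist E u w e) → Ecc E u e
  eccentricity reach far = (λ w d δ → dist≤reach (reach w) δ) , far

  central⇒reach : ∀ {x z e} → Connected E → Central E x → Ecc E z e → ∀ w → ReachableIn e x w
  central⇒reach conn (_ , (bounded , _) , minimal) ecc w =
    let (k , walk) = conn _ w
        (d , δ@(shortest , _)) = walk⇒dist k walk
    in d , s≤s (≤-trans (bounded w d δ) (minimal _ _ ecc)) , shortest

  central-candidates : ∀ {C : Fin n → Set} {z e} → Connected E → Ecc E z e →
                       (∀ x → C x ⊎ ∃ λ w → ¬ ReachableIn e x w) → ∀ {x} → Central E x → C x
  central-candidates conn ecc candidates {x} central with candidates x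
  ... | inj₁ cx = cx
  ... | inj₂ (w , far) = ⊥-elim (far (central⇒reach conn central ecc w))

  near-path : ∀ {D p} → (∀ x → Any (λ w → ∃ λ d → d < suc D × Dist E x w d) p) →
         ∀ x → ∃ λ w → w ∈ p × ∃ λ d → Dist E x w d × d ≤ D
  near-path reach x = let (w , w∈p , d , d<1+D , δ) = find (reach x) in w , w∈p , d , δ , s≤s⁻¹ d<1+D

  data AvoidingPath : List (Fin n) → Fin n → ℕ → Set where
    stop : ∀ {vs u} → AvoidingPath vs u zero
    step : ∀ {vs u w k} → Adjacent E u w → All (w ≢_) (u ∷ vs) →
           AvoidingPath (u ∷ vs) w k → AvoidingPath vs u (suc k)

  avoidingPath? : ∀ vs u k → Dec (AvoidingPath vs u k)
  avoidingPath? vs u zero = yes stop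
  avoidingPath? vs u (suc k) =
    map′ (λ (w , u~w , fresh , path) → step u~w fresh path)
         (λ { (step u~w fresh path) → _ , u~w , fresh , path })
         (any? λ w → adjacent? u w ×-dec All.all? (λ x → ¬? (w ≟ x)) (u ∷ vs) ×-dec avoidingPath? (u ∷ vs) w k)

  path⇒avoidingPath : ∀ {vs u} q → Unique (u ∷ q) → Linked (Adjacent E) (u ∷ q) →
                      All (λ x → All (x ≢_) vs) q → AvoidingPath vs u (length q)
  path⇒avoidingPath [] _ _ _ = stop
  path⇒avoidingPath (w ∷ q) ((u≢w ∷ u≢q) ∷ unique) (u~w ∷ linked) (w-fresh ∷ q-fresh) =
    step u~w ((u≢w ∘ sym) ∷ w-fresh)
         (path⇒avoidingPath q unique linked (All.zipWith (λ (u≢x , x-fresh) → (u≢x ∘ sym) ∷ x-fresh) (u≢q , q-fresh)))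

  truncate : ∀ {vs u k m} → k ≤ m → AvoidingPath vs u m → AvoidingPath vs u k
  truncate z≤n _ = stop
  truncate (s≤s k≤m) (step u~w fresh path) = step u~w fresh (truncate k≤m path)

  path-length-bounded : ∀ {k} → (∀ u → ¬ AvoidingPath [] u k) → ∀ p → IsPath E p → length p ≤ k
  path-length-bounded none [] _ = z≤n
  path-length-bounded {k} none (u ∷ q) (unique , linked) with length q <? k
  ... | yes q<k = q<k
  ... | no q≮k = ⊥-elim (none u (truncate (≮⇒≥ q≮k) (path⇒avoidingPath q unique linked (All.universal (λ _ → []) q))))

two-distinct-in-interval : ∀ {lo hi a b} → lo ≤ a → a < hi → lo ≤ b → b < hi → a ≢ b → 2 + lo ≤ hi
two-distinct-in-interval {a = a} {b} lo≤a a<hi lo≤b b<hi a≢b with <-cmp a b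
... | tri< a<b _ _ = ≤-trans (s≤s (s≤s lo≤a)) (≤-trans (s≤s a<b) b<hi)
... | tri≈ _ a≡b _ = ⊥-elim (a≢b a≡b)
... | tri> _ _ b<a = ≤-trans (s≤s (s≤s lo≤b)) (≤-trans (s≤s b<a) a<hi)

extreme-pair : ∀ {m x y} → x ≤ m → y ≤ m → ∣ x - y ∣ ≡ m → (x ≡ 0 × y ≡ m) ⊎ (y ≡ 0 × x ≡ m)
extreme-pair {x = zero} _ _ weight = inj₁ (refl , weight)
extreme-pair {x = suc x} {zero} _ _ weight = inj₂ (refl , weight)
extreme-pair {x = suc x} {suc y} x<m y<m weight =
  ⊥-elim (<⇒≱ (≤-trans (s≤s (∣m-n∣≤m⊔n x y)) (⊔-lub x<m y<m)) (≤-reflexive (sym weight)))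

unit-gap : ∀ {c x y} → x ≤ c → c < y → ∣ x - y ∣ ≡ 1 → x ≡ c × y ≡ suc c
unit-gap {c} {x} {y} x≤c c<y weight = x≡c , trans y≡1+x (cong suc x≡c)
  where
  x≤y : x ≤ y
  x≤y = ≤-trans x≤c (<⇒≤ c<y)
  y≡1+x : y ≡ suc x
  y≡1+x = trans (sym (m∸n+n≡m x≤y)) (cong (_+ x) (trans (sym (m≤n⇒∣m-n∣≡n∸m x≤y)) weight))
  x≡c : x ≡ c
  x≡c = ≤-antisym x≤c (s≤s⁻¹ (subst (suc c ≤_) y≡1+x c<y))

edge-weight : ∀ {n} → (Fin n → ℕ) → Fin n × Fin n → ℕ
edge-weight f (u , w) = ∣ f u - f w ∣

edge-weight-cong : ∀ {n} {f g : Fin n → ℕ} → f ≗ g → edge-weight f ≗ edge-weight g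
edge-weight-cong f≗g (u , w) = cong₂ ∣_-_∣ (f≗g u) (f≗g w)

module _ {m : ℕ} {E : EdgeList (suc m)} {f : Fin (suc m) → ℕ} {c : ℕ} (α : AlphaLabeling E f c) where

  α-injective : ∀ {u w} → f u ≡ f w → u ≡ w
  α-injective = proj₁ (proj₁ α)

  α-bounded : ∀ u → f u ≤ m
  α-bounded u = s≤s⁻¹ (proj₁ (proj₂ (proj₁ α)) u)

  α-covers : ∀ {k} → 1 ≤ k → k ≤ m → ∃₂ λ u w → (u , w) ∈ E × ∣ f u - f w ∣ ≡ k
  α-covers 1≤k k≤m = Equivalence.to (proj₂ (proj₂ (proj₁ α)) _) (1≤k , k≤m)

  α-weight-listed : ∀ {k} → 1 ≤ k → k ≤ m → k ∈ map (edge-weight f) E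
  α-weight-listed 1≤k k≤m with α-covers 1≤k k≤m
  ... | u , w , e , refl = ∈-map⁺ (edge-weight f) e

  α-separated : ∀ {u w} → Adjacent E u w → (f u ≤ c × c < f w) ⊎ (f w ≤ c × c < f u)
  α-separated (inj₁ e) = All.lookup (proj₂ α) e
  α-separated (inj₂ e) = swap (All.lookup (proj₂ α) e)

  α-low⇒high : ∀ {u w} → Adjacent E u w → f u ≤ c → c < f w
  α-low⇒high u~w fu≤c with α-separated u~w
  ... | inj₁ (_ , c<fw) = c<fw
  ... | inj₂ (_ , c<fu) = ⊥-elim (<⇒≱ c<fu fu≤c)

  α-high⇒low : ∀ {u w} → Adjacent E u w → c < f u → f w ≤ c
  α-high⇒low u~w c<fu with α-separated u~w
  ... | inj₁ (fu≤c , _) = ⊥-elim (<⇒≱ c<fu fu≤c)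
  ... | inj₂ (fw≤c , _) = fw≤c

  α-heaviest-edge : 1 ≤ m → ∃₂ λ u w → Adjacent E u w × f u ≡ 0 × f w ≡ m
  α-heaviest-edge 1≤m with α-covers 1≤m ≤-refl
  ... | u , w , e , weight with extreme-pair (α-bounded u) (α-bounded w) weight
  ... | inj₁ (fu≡0 , fw≡m) = u , w , inj₁ e , fu≡0 , fw≡m
  ... | inj₂ (fw≡0 , fu≡m) = w , u , inj₂ e , fw≡0 , fu≡m

  α-lightest-edge : 1 ≤ m → ∃₂ λ u w → Adjacent E u w × f u ≡ c × f w ≡ suc c
  α-lightest-edge 1≤m with α-covers ≤-refl 1≤m
  ... | u , w , e , weight with α-separated (inj₁ e)
  ... | inj₁ (fu≤c , c<fw) = u , w , inj₁ e , unit-gap fu≤c c<fw weight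
  ... | inj₂ (fw≤c , c<fu) = w , u , inj₂ e , unit-gap fw≤c c<fu (trans (∣-∣-comm (f w) (f u)) weight)

  α-distinct : ∀ {u w} → u ≢ w → f u ≢ f w
  α-distinct u≢w = u≢w ∘ α-injective

  α-label-taken : ∀ {u w k} → u ≢ w → f w ≡ k → f u ≢ k
  α-label-taken u≢w fw≡k fu≡k = α-distinct u≢w (trans fu≡k (sym fw≡k))

  α-two-low⇒critical≢0 : ∀ {u w} → u ≢ w → f u ≤ c → f w ≤ c → c ≢ 0
  α-two-low⇒critical≢0 u≢w fu≤c fw≤c refl = α-distinct u≢w (trans (n≤0⇒n≡0 fu≤c) (sym (n≤0⇒n≡0 fw≤c)))

pattern u₁ = zero
pattern u₂ = suc zero
pattern v₁ = suc (suc zero)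
pattern v  = suc (suc (suc zero))
pattern v₂ = suc (suc (suc (suc zero)))
pattern u₃ = suc (suc (suc (suc (suc zero))))
pattern v₃ = suc (suc (suc (suc (suc (suc zero)))))

S : EdgeList 7
S = (u₁ , v₁) ∷ (u₂ , v₁) ∷ (v₁ , v) ∷ (v , v₂) ∷ (v₂ , u₃) ∷ (u₃ , v₃) ∷ []

spine : List (Fin 7)
spine = u₁ ∷ v₁ ∷ v ∷ v₂ ∷ u₃ ∷ v₃ ∷ []

-- The decided facts are used only as arguments of the generic lemmas above: taking them apart
-- here would make Agda unfold the decision procedures.
S-reachable-in-5 : ∀ x y → ReachableIn S 5 x y
S-reachable-in-5 = from-yes (all? λ x → all? (reachableIn? S 5 x))

S-diameter : Diameter S 5
S-diameter = diameter S S-reachable-in-5 (u₁ , v₃ , from-yes (dist? S u₁ v₃ 5))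

S-connected : Connected S
S-connected = connected S S-reachable-in-5

S-tree : IsTree S
S-tree = s≤s z≤n , from-yes (simple? S) , S-connected , refl

S-near-spine : ∀ x → Any (λ w → ∃ λ d → d < 3 × Dist S x w d) spine
S-near-spine = from-yes (all? λ x → Any.any? (λ w → anyUpTo? (dist? S x w) 3) spine)

S-no-path-of-7 : ∀ u → ¬ AvoidingPath S [] u 6
S-no-path-of-7 = from-yes (all? λ u → ¬? (avoidingPath? S [] u 6))

S-lobster : IsLobster S
S-lobster = S-tree , spine , (from-yes (isPath? S spine) , path-length-bounded S S-no-path-of-7) , near-path S S-near-spine

S-ecc-v : Ecc S v 3
S-ecc-v = eccentricity S (from-yes (all? (reachableIn? S 3 v))) (v₃ , from-yes (dist? S v v₃ 3))

S-centre-or-far : ∀ x → (x ≡ v ⊎ x ≡ v₂) ⊎ ∃ λ w → ¬ ReachableIn S 3 x w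
S-centre-or-far = from-yes (all? λ x → ((x ≟ v) ⊎-dec (x ≟ v₂)) ⊎-dec any? λ w → ¬? (reachableIn? S 3 x w))

S-central : ∀ {x} → Central S x → x ≡ v ⊎ x ≡ v₂
S-central = central-candidates S S-connected S-ecc-v S-centre-or-far

edge : ∀ u w → {True (adjacent? S u w)} → Adjacent S u w
edge u w {adjacent} = toWitness adjacent

S-neighbours-v : ∀ x → Adjacent S v x → x ≡ v₁ ⊎ x ≡ v₂
S-neighbours-v = from-yes (all? λ x → adjacent? S v x →-dec ((x ≟ v₁) ⊎-dec (x ≟ v₂)))

S-neighbours-v₂ : ∀ x → Adjacent S v₂ x → x ≡ v ⊎ x ≡ u₃
S-neighbours-v₂ = from-yes (all? λ x → adjacent? S v₂ x →-dec ((x ≟ v) ⊎-dec (x ≟ u₃)))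

forced-v-critical : ℕ → ℕ → Fin 7 → ℕ
forced-v-critical a b u₁ = a
forced-v-critical a b u₂ = b
forced-v-critical a b v₁ = 4
forced-v-critical a b v  = 3
forced-v-critical a b v₂ = 6
forced-v-critical a b u₃ = 0
forced-v-critical a b v₃ = 5

∣x-4∣≢4 : ∀ {x} → 1 ≤ x → x < 3 → ∣ x - 4 ∣ ≢ 4
∣x-4∣≢4 {1} _ _ ()
∣x-4∣≢4 {2} _ _ ()
∣x-4∣≢4 {suc (suc (suc _))} _ (s≤s (s≤s (s≤s ())))

weight-4-absent : ∀ {a b} → 1 ≤ a → a < 3 → 1 ≤ b → b < 3 → 4 ∉ map (edge-weight (forced-v-critical a b)) S
weight-4-absent 1≤a a<3 _ _ (here 4≡w) = ∣x-4∣≢4 1≤a a<3 (sym 4≡w)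
weight-4-absent _ _ 1≤b b<3 (there (here 4≡w)) = ∣x-4∣≢4 1≤b b<3 (sym 4≡w)
weight-4-absent _ _ _ _ (there (there (here ())))
weight-4-absent _ _ _ _ (there (there (there (here ()))))
weight-4-absent _ _ _ _ (there (there (there (there (here ())))))
weight-4-absent _ _ _ _ (there (there (there (there (there (here ()))))))
weight-4-absent _ _ _ _ (there (there (there (there (there (there ()))))))

forced-v₂-critical : ℕ → ℕ → Fin 7 → ℕ
forced-v₂-critical a b u₁ = a
forced-v₂-critical a b u₂ = b
forced-v₂-critical a b v₁ = 0
forced-v₂-critical a b v  = 6
forced-v₂-critical a b v₂ = 2
forced-v₂-critical a b u₃ = 3
forced-v₂-critical a b v₃ = 1

weight-3-absent : ∀ {a b} → 3 < a → 3 < b → 3 ∉ map (edge-weight (forced-v₂-critical a b)) S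
weight-3-absent {a} 3<a _ (here 3≡w) = <⇒≱ 3<a (≤-reflexive (trans (sym (∣-∣-identityʳ a)) (sym 3≡w)))
weight-3-absent {b = b} _ 3<b (there (here 3≡w)) = <⇒≱ 3<b (≤-reflexive (trans (sym (∣-∣-identityʳ b)) (sym 3≡w)))
weight-3-absent _ _ (there (there (here ())))
weight-3-absent _ _ (there (there (there (here ()))))
weight-3-absent _ _ (there (there (there (there (here ())))))
weight-3-absent _ _ (there (there (there (there (there (here ()))))))
weight-3-absent _ _ (there (there (there (there (there (there ()))))))

module _ {f : Fin 7 → ℕ} {c : ℕ} (α : AlphaLabeling S f c) where

  no-α-with-v-critical : f v ≡ c → f v₂ ≡ 6 → ⊥
  no-α-with-v-critical fv≡c fv₂≡6 =
    weight-4-absent u₁-above-0 u₁-below-3 u₂-above-0 u₂-below-3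
      (subst (4 ∈_) (map-cong (edge-weight-cong forced) S) (α-weight-listed α (s≤s z≤n) (s≤s (s≤s (s≤s (s≤s z≤n))))))
    where
    taken : ∀ {x y k} → x ≢ y → f y ≡ k → f x ≢ k
    taken = α-label-taken α

    v₁-high : c < f v₁
    v₁-high = α-low⇒high α (edge v v₁) (≤-reflexive fv≡c)
    u₁-low : f u₁ ≤ c
    u₁-low = α-high⇒low α (edge v₁ u₁) v₁-high
    u₂-low : f u₂ ≤ c
    u₂-low = α-high⇒low α (edge v₁ u₂) v₁-high
    u₃-low : f u₃ ≤ c
    u₃-low = α-high⇒low α (edge v₂ u₃) (α-low⇒high α (edge v v₂) (≤-reflexive fv≡c))
    v₃-high : c < f v₃
    v₃-high = α-low⇒high α (edge u₃ v₃) u₃-low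

    u₃-zero : f u₃ ≡ 0
    u₃-zero with α-heaviest-edge α (s≤s z≤n)
    ... | x , y , x~y , fx≡0 , fy≡6 with α-injective α (trans fy≡6 (sym fv₂≡6))
    ... | refl with S-neighbours-v₂ x (swap x~y)
    ... | inj₂ refl = fx≡0
    ... | inj₁ refl = ⊥-elim (α-two-low⇒critical≢0 α {u₁} {u₂} (λ ()) u₁-low u₂-low (trans (sym fv≡c) fx≡0))

    v₁-next : f v₁ ≡ suc c
    v₁-next with α-lightest-edge α (s≤s z≤n)
    ... | x , y , x~y , fx≡c , fy≡1+c with α-injective α (trans fx≡c (sym fv≡c))
    ... | refl with S-neighbours-v y x~y
    ... | inj₁ refl = fy≡1+c
    ... | inj₂ refl = ⊥-elim (taken {v₁} (λ ()) fy≡1+c v₁-squeezed)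
      where
      v₁-squeezed : f v₁ ≡ suc c
      v₁-squeezed = ≤-antisym (subst (f v₁ ≤_) (trans (sym fv₂≡6) fy≡1+c) (α-bounded α v₁)) v₁-high

    v₃-above-c+1 : 2 + c ≤ f v₃
    v₃-above-c+1 = ≤∧≢⇒< v₃-high (≢-sym (taken (λ ()) v₁-next))
    v₃-below-6 : f v₃ < 6
    v₃-below-6 = ≤∧≢⇒< (α-bounded α v₃) (taken (λ ()) fv₂≡6)

    u₁-above-0 : 1 ≤ f u₁
    u₁-above-0 = n≢0⇒n>0 (taken (λ ()) u₃-zero)
    u₂-above-0 : 1 ≤ f u₂
    u₂-above-0 = n≢0⇒n>0 (taken (λ ()) u₃-zero)
    u₁-below-c : f u₁ < c
    u₁-below-c = ≤∧≢⇒< u₁-low (taken (λ ()) fv≡c)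
    u₂-below-c : f u₂ < c
    u₂-below-c = ≤∧≢⇒< u₂-low (taken (λ ()) fv≡c)

    c≡3 : c ≡ 3
    c≡3 = ≤-antisym (s≤s⁻¹ (s≤s⁻¹ (s≤s⁻¹ (≤-trans (s≤s v₃-above-c+1) v₃-below-6))))
                    (two-distinct-in-interval u₁-above-0 u₁-below-c u₂-above-0 u₂-below-c (α-distinct α (λ ())))

    u₁-below-3 : f u₁ < 3
    u₁-below-3 = subst (f u₁ <_) c≡3 u₁-below-c
    u₂-below-3 : f u₂ < 3
    u₂-below-3 = subst (f u₂ <_) c≡3 u₂-below-c

    forced : f ≗ forced-v-critical (f u₁) (f u₂)
    forced u₁ = refl
    forced u₂ = refl
    forced v₁ = trans v₁-next (cong suc c≡3)
    forced v  = trans fv≡c c≡3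
    forced v₂ = fv₂≡6
    forced u₃ = u₃-zero
    forced v₃ = ≤-antisym (s≤s⁻¹ v₃-below-6) (subst (λ k → 2 + k ≤ f v₃) c≡3 v₃-above-c+1)

  no-α-with-v₂-critical : f v₂ ≡ c → f v ≡ 6 → ⊥
  no-α-with-v₂-critical fv₂≡c fv≡6 =
    weight-3-absent u₁-above-3 u₂-above-3
      (subst (3 ∈_) (map-cong (edge-weight-cong forced) S) (α-weight-listed α (s≤s z≤n) (s≤s (s≤s (s≤s z≤n)))))
    where
    taken : ∀ {x y k} → x ≢ y → f y ≡ k → f x ≢ k
    taken = α-label-taken α

    v-high : c < f v
    v-high = α-low⇒high α (edge v₂ v) (≤-reflexive fv₂≡c)
    u₃-high : c < f u₃
    u₃-high = α-low⇒high α (edge v₂ u₃) (≤-reflexive fv₂≡c)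
    v₃-low : f v₃ ≤ c
    v₃-low = α-high⇒low α (edge u₃ v₃) u₃-high
    v₁-low : f v₁ ≤ c
    v₁-low = α-high⇒low α (edge v v₁) v-high
    u₁-high : c < f u₁
    u₁-high = α-low⇒high α (edge v₁ u₁) v₁-low
    u₂-high : c < f u₂
    u₂-high = α-low⇒high α (edge v₁ u₂) v₁-low

    v₁-zero : f v₁ ≡ 0
    v₁-zero with α-heaviest-edge α (s≤s z≤n)
    ... | x , y , x~y , fx≡0 , fy≡6 with α-injective α (trans fy≡6 (sym fv≡6))
    ... | refl with S-neighbours-v x (swap x~y)
    ... | inj₁ refl = fx≡0
    ... | inj₂ refl = ⊥-elim (α-two-low⇒critical≢0 α {v₁} {v₃} (λ ()) v₁-low v₃-low (trans (sym fv₂≡c) fx≡0))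

    u₃-next : f u₃ ≡ suc c
    u₃-next with α-lightest-edge α (s≤s z≤n)
    ... | x , y , x~y , fx≡c , fy≡1+c with α-injective α (trans fx≡c (sym fv₂≡c))
    ... | refl with S-neighbours-v₂ y x~y
    ... | inj₂ refl = fy≡1+c
    ... | inj₁ refl = ⊥-elim (taken {u₃} (λ ()) fy≡1+c u₃-squeezed)
      where
      u₃-squeezed : f u₃ ≡ suc c
      u₃-squeezed = ≤-antisym (subst (f u₃ ≤_) (trans (sym fv≡6) fy≡1+c) (α-bounded α u₃)) u₃-high

    v₃-above-0 : 1 ≤ f v₃
    v₃-above-0 = n≢0⇒n>0 (taken (λ ()) v₁-zero)
    v₃-below-c : f v₃ < c
    v₃-below-c = ≤∧≢⇒< v₃-low (taken (λ ()) fv₂≡c)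

    u₁-above-c+1 : 2 + c ≤ f u₁
    u₁-above-c+1 = ≤∧≢⇒< u₁-high (≢-sym (taken (λ ()) u₃-next))
    u₂-above-c+1 : 2 + c ≤ f u₂
    u₂-above-c+1 = ≤∧≢⇒< u₂-high (≢-sym (taken (λ ()) u₃-next))
    u₁-below-6 : f u₁ < 6
    u₁-below-6 = ≤∧≢⇒< (α-bounded α u₁) (taken (λ ()) fv≡6)
    u₂-below-6 : f u₂ < 6
    u₂-below-6 = ≤∧≢⇒< (α-bounded α u₂) (taken (λ ()) fv≡6)

    c≡2 : c ≡ 2
    c≡2 = ≤-antisym (s≤s⁻¹ (s≤s⁻¹ (s≤s⁻¹ (s≤s⁻¹ (two-distinct-in-interval u₁-above-c+1 u₁-below-6
                                                                        u₂-above-c+1 u₂-below-6 (α-distinct α (λ ())))))))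
                    (≤-trans (s≤s v₃-above-0) v₃-below-c)

    u₁-above-3 : 3 < f u₁
    u₁-above-3 = subst (λ k → 2 + k ≤ f u₁) c≡2 u₁-above-c+1
    u₂-above-3 : 3 < f u₂
    u₂-above-3 = subst (λ k → 2 + k ≤ f u₂) c≡2 u₂-above-c+1

    forced : f ≗ forced-v₂-critical (f u₁) (f u₂)
    forced u₁ = refl
    forced u₂ = refl
    forced v₁ = v₁-zero
    forced v  = fv≡6
    forced v₂ = trans fv₂≡c c≡2
    forced u₃ = trans u₃-next (cong suc c≡2)
    forced v₃ = ≤-antisym (s≤s⁻¹ (subst (f v₃ <_) c≡2 v₃-below-c)) v₃-above-0

no-α-on-v-and-v₂ : ∀ {f c x y} → x ≡ v ⊎ x ≡ v₂ → y ≡ v ⊎ y ≡ v₂ → x ≢ y →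
                   AlphaLabeling S f c → f x ≡ c → f y ≡ 6 → ⊥
no-α-on-v-and-v₂ (inj₁ refl) (inj₁ refl) x≢y _ _ _ = x≢y refl
no-α-on-v-and-v₂ (inj₂ refl) (inj₂ refl) x≢y _ _ _ = x≢y refl
no-α-on-v-and-v₂ (inj₁ refl) (inj₂ refl) _ α fx≡c fy≡6 = no-α-with-v-critical α fx≡c fy≡6
no-α-on-v-and-v₂ (inj₂ refl) (inj₁ refl) _ α fx≡c fy≡6 = no-α-with-v₂-critical α fx≡c fy≡6

mainTheorem1 : Σ ℕ λ n → Σ (EdgeList n) λ S → IsLobster S × Diameter S 5 ×
    ¬ (Σ (Fin n → ℕ) λ f → Σ ℕ λ c → Σ (Fin n) λ x → Σ (Fin n) λ y →
         Central S x × Central S y × x ≢ y × AlphaLabeling S f c × f x ≡ c × f y ≡ n ∸ 1)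
mainTheorem1 = 7 , S , S-lobster , S-diameter ,
  λ (f , c , x , y , cx , cy , x≢y , α , fx≡c , fy≡6) → no-α-on-v-and-v₂ (S-central cx) (S-central cy) x≢y α fx≡c fy≡6
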